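{- If $G$ is a König–Egerváry graph, then the following are equivalent: (i) $\xi(G)+\eta(G)=\alpha(G)$; (ii) $\sigma(G)+\eta(G)=\mu(G)$; (iii) $\xi(G)+2\eta(G)+\sigma(G)=n(G)$.
   Context: All graphs are finite and simple; "graph" means a connected graph with at least one edge. $\alpha(G)$ is the stability number, $\mu(G)$ the maximum matching size, $n(G)=|V(G)|$; $G$ is König–Egerváry if $\alpha(G)+\mu(G)=n(G)$. $\Omega(G)$ is the set of maximum stable sets, $\mathrm{core}(G)=\bigcap\{S:S\in\Omega(G)\}$, $\xi(G)=|\mathrm{core}(G)|$, $\sigma(G)=\left|\bigcap\{V(G)-S:S\in\Omega(G)\}\right|$. An edge $e$ is $\alpha$-critical if $\alpha(G-e)>\alpha(G)$ ($G-e$ being $G$ with $e$ deleted), and $\eta(G)$ is the number of $\alpha$-critical edges of $G$. -}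

module Defs where

open import Data.Nat using (ℕ; _+_; _*_; _≤_; _<_)
open import Data.Bool using (Bool; true; false; _∧_; _∨_; not)
open import Data.Fin using (Fin; toℕ; _≟_)
open import Data.Fin.Subset using (Subset; _∈_; _∉_; ∣_∣)
open import Data.Product using (Σ; ∃; ∃-syntax; _×_; _,_)
open import Data.List using (List; []; _∷_; length; concatMap)
open import Data.List.Membership.Propositional using () renaming (_∈_ to _∈ₗ_)
open import Data.List.Relation.Unary.All using (All)
open import Data.List.Relation.Unary.Unique.Propositional using (Unique)
open import Relation.Binary.PropositionalEquality using (_≡_)
open import Relation.Nullary.Decidable using (⌊_⌋)
open import Function.Bundles using (_⇔_)

Adj : ℕ → Set
Adj n = Fin n → Fin n → Bool

data Reach {n : ℕ} (A : Adj n) : Fin n → Fin n → Set where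
  here : ∀ {u} → Reach A u u
  step : ∀ {u v w} → A u v ≡ true → Reach A v w → Reach A u w

-- "graph" in the paper's sense: finite, simple (symmetric, loopless),
-- connected, with at least one edge.
record IsGraph {n : ℕ} (A : Adj n) : Set where
  field
    symmetric   : ∀ u v → A u v ≡ A v u
    irreflexive : ∀ u → A u u ≡ false
    connected   : ∀ u v → Reach A u v
    hasEdge     : ∃[ u ] ∃[ v ] (A u v ≡ true)

Stable : ∀ {n} → Adj n → Subset n → Set
Stable A S = ∀ u v → u ∈ S → v ∈ S → A u v ≡ false

MaxStable : ∀ {n} → Adj n → Subset n → Set
MaxStable A S = Stable A S × (∀ T → Stable A T → ∣ T ∣ ≤ ∣ S ∣)

IsAlpha : ∀ {n} → Adj n → ℕ → Set
IsAlpha A k = (∃[ S ] (Stable A S × ∣ S ∣ ≡ k)) × (∀ T → Stable A T → ∣ T ∣ ≤ k)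

endpoints : ∀ {n} → List (Fin n × Fin n) → List (Fin n)
endpoints = concatMap (λ { (u , v) → u ∷ v ∷ [] })

IsMatching : ∀ {n} → Adj n → List (Fin n × Fin n) → Set
IsMatching A M = All (λ { (u , v) → A u v ≡ true }) M × Unique (endpoints M)

IsMu : ∀ {n} → Adj n → ℕ → Set
IsMu A k = (∃[ M ] (IsMatching A M × length M ≡ k))
         × (∀ M → IsMatching A M → length M ≤ k)

IsXi : ∀ {n} → Adj n → ℕ → Set
IsXi A k = ∃[ C ] ((∀ v → v ∈ C ⇔ (∀ S → MaxStable A S → v ∈ S)) × ∣ C ∣ ≡ k)

IsSigma : ∀ {n} → Adj n → ℕ → Set
IsSigma A k = ∃[ C ] ((∀ v → v ∈ C ⇔ (∀ S → MaxStable A S → v ∉ S)) × ∣ C ∣ ≡ k)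

deleteEdge : ∀ {n} → Adj n → Fin n → Fin n → Adj n
deleteEdge A u v x y =
  A x y ∧ not ((⌊ x ≟ u ⌋ ∧ ⌊ y ≟ v ⌋) ∨ (⌊ x ≟ v ⌋ ∧ ⌊ y ≟ u ⌋))

AlphaCritical : ∀ {n} → Adj n → Fin n → Fin n → Set
AlphaCritical A u v =
  ∃[ a ] ∃[ a' ] (IsAlpha A a × IsAlpha (deleteEdge A u v) a' × a < a')

-- η(G) = k : the α-critical edges, each unordered edge {u,v} listed once
-- as the pair (u,v) with u < v.
IsEta : ∀ {n} → Adj n → ℕ → Set
IsEta A k = ∃[ L ] (Unique L
  × (∀ u v → (u , v) ∈ₗ L ⇔ (toℕ u < toℕ v × A u v ≡ true × AlphaCritical A u v))
  × length L ≡ k)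

KonigEgervary : ∀ {n} → Adj n → Set
KonigEgervary {n} A = ∀ a m → IsAlpha A a → IsMu A m → a + m ≡ n

-- Only ξ + μ = σ + α matters: together with α + μ = n it makes the three conditions
-- equivalent by arithmetic alone, for any value of η.
--
-- Fix a maximum matching M and a maximum stable set S₀. For every maximum stable set S,
-- |V − S| = n − α = μ, while each of the μ disjoint edges of M has an endpoint in V − S;
-- so every edge of M has exactly one endpoint in S and every unmatched vertex lies in S.
-- Hence for matched partners u, w: u ∈ core ⇔ w ∈ ⋂(V − S) and u ∉ S₀ ⇔ w ∈ S₀, while an
-- unmatched vertex lies in core and in S₀ but neither in ⋂(V − S) nor in V − S₀. Swapping
-- matched partners thus turns the indicators of core and V − S₀ into those of ⋂(V − S)
-- and S₀, and summing over V gives ξ + μ = σ + α.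

{-# OPTIONS --safe #-}
module Submission where

open import Defs
open import Data.Nat using (ℕ; _+_; _*_)
open import Data.Product using (_×_)
open import Relation.Binary.PropositionalEquality using (_≡_)
open import Function.Bundles using (_⇔_)

open import Data.Nat using (suc; _∸_; _≤_; z≤n; s≤s)
open import Data.Nat.Properties
  using (+-0-commutativeMonoid; +-commutativeSemigroup; +-comm; +-assoc; +-identityʳ;
         +-cancelʳ-≡; *-cancelˡ-≡; m+n≡0⇒m≡0; m+n≡0⇒n≡0; m+n∸m≡n; suc-injective; ≤-antisym)
open import Algebra.Properties.CommutativeMonoid.Sum +-0-commutativeMonoid
  using (sum-syntax; sum-cong-≗; ∑-distrib-+; sum-replicate-zero)
open import Algebra.Properties.CommutativeSemigroup +-commutativeSemigroup
  using (x∙yz≈yx∙z; xy∙z≈y∙xz; xy∙z≈xz∙y)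
open import Data.Bool using (true; if_then_else_)
open import Data.Fin using (Fin; zero; suc; _≟_)
open import Data.Fin.Subset using (Subset; _∈_; _∉_; ∁; ∣_∣; inside; outside)
open import Data.Fin.Subset.Properties
  using (_∈?_; x∈∁p⇒x∉p; x∉p⇒x∈∁p; x∉∁p⇒x∈p; ∣∁p∣≡n∸∣p∣)
open import Data.List using (List; []; _∷_; map; length)
open import Data.List.Membership.Propositional using () renaming (_∈_ to _∈ₗ_; _∉_ to _∉ₗ_)
open import Data.List.Relation.Unary.Any using (any?)
open import Data.List.Properties using (length-map; map-cong-local)
open import Data.List.Relation.Unary.All as All using (All; []; _∷_)
import Data.List.Relation.Unary.All.Properties as All
open import Data.List.Relation.Unary.AllPairs using ([]; _∷_)
open import Data.List.Relation.Unary.Unique.Propositional using (Unique)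
open import Data.Nat.ListAction using (sum)
open import Data.Nat.Tactic.RingSolver using (solve-∀)
open import Data.Product using (Σ; _,_; proj₁; proj₂; map₁)
open import Data.Vec using ([]; _∷_)
open import Function.Bundles using (Equivalence; mk⇔)
open import Relation.Binary.PropositionalEquality
  using (refl; sym; trans; cong; cong₂; subst; subst₂; _≗_; module ≡-Reasoning)
open import Relation.Nullary using (yes; no; does; contradiction)

open Equivalence using (to; from)
open ≡-Reasoning

private
  variable
    n a m : ℕ
    A : Adj n
    p q T : Subset n
    u v w y : Fin n
    L : List (Fin n)
    M : List (Fin n × Fin n)
    h g : Fin n → ℕ

χ : Subset n → Fin n → ℕ
χ p v = if does (v ∈? p) then 1 else 0

∣p∣≡∑χ : (p : Subset n) → ∣ p ∣ ≡ ∑[ v < n ] χ p v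
∣p∣≡∑χ []            = refl
∣p∣≡∑χ (inside  ∷ p) = cong suc (∣p∣≡∑χ p)
∣p∣≡∑χ (outside ∷ p) = ∣p∣≡∑χ p

χ-cong : u ∈ p ⇔ w ∈ q → χ p u ≡ χ q w
χ-cong {u = u} {p = p} {w = w} {q = q} u∈p⇔w∈q with u ∈? p | w ∈? q
... | yes _   | yes _   = refl
... | no  _   | no  _   = refl
... | yes u∈p | no  w∉q = contradiction (to u∈p⇔w∈q u∈p) w∉q
... | no  u∉p | yes w∈q = contradiction (from u∈p⇔w∈q w∈q) u∉p

χ≡0⇒∉ : χ p v ≡ 0 → v ∉ p
χ≡0⇒∉ {p = p} {v = v} with v ∈? p
... | yes _   = λ ()
... | no  v∉p = λ _ → v∉p

χ∁+χ∁≡1⇒∈⇔∉ : χ (∁ p) u + χ (∁ p) w ≡ 1 → u ∈ p ⇔ w ∉ p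
χ∁+χ∁≡1⇒∈⇔∉ {p = p} {u = u} {w = w} with u ∈? ∁ p | w ∈? ∁ p
... | yes _    | yes _    = λ ()
... | no  _    | no  _    = λ ()
... | yes u∈∁p | no  w∉∁p = λ _ →
  mk⇔ (λ u∈p → contradiction u∈p (x∈∁p⇒x∉p u∈∁p)) (contradiction (x∉∁p⇒x∈p w∉∁p))
... | no  u∉∁p | yes w∈∁p = λ _ →
  mk⇔ (λ _ → x∈∁p⇒x∉p w∈∁p) (λ _ → x∉∁p⇒x∈p u∉∁p)

∑≡0⇒≡0 : ∑[ v < n ] h v ≡ 0 → ∀ v → h v ≡ 0
∑≡0⇒≡0 {h = h} ∑≡0 zero    = m+n≡0⇒m≡0 (h zero) ∑≡0
∑≡0⇒≡0 {h = h} ∑≡0 (suc v) = ∑≡0⇒≡0 (m+n≡0⇒n≡0 (h zero) ∑≡0) v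

∑-single : ∀ (y : Fin n) c → ∑[ v < n ] (if does (v ≟ y) then c else 0) ≡ c
∑-single {suc n} zero    c = trans (cong (c +_) (sum-replicate-zero n)) (+-identityʳ c)
∑-single {suc n} (suc y) c = ∑-single y c

zeroOn : List (Fin n) → (Fin n → ℕ) → Fin n → ℕ
zeroOn L h v = if does (any? (v ≟_) L) then 0 else h v

zeroOn-∉ : v ∉ₗ L → zeroOn L h v ≡ h v
zeroOn-∉ {v = v} {L = L} v∉L with any? (v ≟_) L
... | yes v∈L = contradiction v∈L v∉L
... | no  _   = refl

zeroOn-cong : (∀ v → v ∉ₗ L → h v ≡ g v) → zeroOn L h ≗ zeroOn L g
zeroOn-cong {L = L} h≡g v with any? (v ≟_) L
... | yes _   = refl
... | no  v∉L = h≡g v v∉L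

zeroOn-∷ : y ∉ₗ L → ∀ h v →
  zeroOn L h v ≡ (if does (v ≟ y) then h y else 0) + zeroOn (y ∷ L) h v
zeroOn-∷ {y = y} {L = L} y∉L h v with v ≟ y | any? (v ≟_) L
... | yes refl | yes v∈L = contradiction v∈L y∉L
... | yes refl | no  _   = sym (+-identityʳ (h v))
... | no  _    | yes _   = refl
... | no  _    | no  _   = refl

∑-split : Unique L → ∀ h → ∑[ v < n ] h v ≡ sum (map h L) + ∑[ v < n ] zeroOn L h v
∑-split [] h = refl
∑-split {L = y ∷ L} (y∉L ∷ L-unique) h = begin
  ∑[ v < _ ] h v                                         ≡⟨ ∑-split L-unique h ⟩
  sum (map h L) + ∑[ v < _ ] zeroOn L h v                ≡⟨ cong (sum (map h L) +_) peel ⟩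
  sum (map h L) + (h y + ∑[ v < _ ] zeroOn (y ∷ L) h v)  ≡⟨ x∙yz≈yx∙z (sum (map h L)) (h y) _ ⟩
  h y + sum (map h L) + ∑[ v < _ ] zeroOn (y ∷ L) h v    ∎
  where
  peel : ∑[ v < _ ] zeroOn L h v ≡ h y + ∑[ v < _ ] zeroOn (y ∷ L) h v
  peel = begin
    ∑[ v < _ ] zeroOn L h v
      ≡⟨ sum-cong-≗ (zeroOn-∷ (All.All¬⇒¬Any y∉L) h) ⟩
    ∑[ v < _ ] ((if does (v ≟ y) then h y else 0) + zeroOn (y ∷ L) h v)
      ≡⟨ ∑-distrib-+ (λ v → if does (v ≟ y) then h y else 0) (zeroOn (y ∷ L) h) ⟩
    ∑[ v < _ ] (if does (v ≟ y) then h y else 0) + ∑[ v < _ ] zeroOn (y ∷ L) h v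
      ≡⟨ cong (_+ ∑[ v < _ ] zeroOn (y ∷ L) h v) (∑-single y (h y)) ⟩
    h y + ∑[ v < _ ] zeroOn (y ∷ L) h v ∎

edgeSum : (Fin n → ℕ) → Fin n × Fin n → ℕ
edgeSum h (u , w) = h u + h w

sum-endpoints : ∀ h (M : List (Fin n × Fin n)) →
  sum (map h (endpoints M)) ≡ sum (map (edgeSum h) M)
sum-endpoints h []            = refl
sum-endpoints h ((u , w) ∷ M) =
  trans (cong (λ t → h u + (h w + t)) (sum-endpoints h M)) (sym (+-assoc (h u) (h w) _))

∑-cong-matching : Unique (endpoints M) →
  All (λ e → edgeSum h e ≡ edgeSum g e) M → (∀ v → v ∉ₗ endpoints M → h v ≡ g v) →
  ∑[ v < n ] h v ≡ ∑[ v < n ] g v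
∑-cong-matching {M = M} {h = h} {g = g} unique on-edges off-edges = begin
  ∑[ v < _ ] h v                                                   ≡⟨ ∑-split unique h ⟩
  sum (map h (endpoints M)) + ∑[ v < _ ] zeroOn (endpoints M) h v  ≡⟨ cong₂ _+_ matched unmatched ⟩
  sum (map g (endpoints M)) + ∑[ v < _ ] zeroOn (endpoints M) g v  ≡⟨ ∑-split unique g ⟨
  ∑[ v < _ ] g v                                                   ∎
  where
  matched : sum (map h (endpoints M)) ≡ sum (map g (endpoints M))
  matched = begin
    sum (map h (endpoints M))  ≡⟨ sum-endpoints h M ⟩
    sum (map (edgeSum h) M)    ≡⟨ cong sum (map-cong-local on-edges) ⟩
    sum (map (edgeSum g) M)    ≡⟨ sum-endpoints g M ⟨
    sum (map g (endpoints M))  ∎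
  unmatched : ∑[ v < _ ] zeroOn (endpoints M) h v ≡ ∑[ v < _ ] zeroOn (endpoints M) g v
  unmatched = sum-cong-≗ (zeroOn-cong off-edges)

sum+r≡length⇒all≡1 : ∀ {xs r} → All (1 ≤_) xs → sum xs + r ≡ length xs → All (_≡ 1) xs × r ≡ 0
sum+r≡length⇒all≡1 [] r≡0 = [] , r≡0
sum+r≡length⇒all≡1 {suc x ∷ xs} {r} (_ ∷ 1≤xs) eq
  with sum+r≡length⇒all≡1 1≤xs (trans (sym (xy∙z≈y∙xz x (sum xs) r)) (suc-injective eq))
... | xs≡1 , x+r≡0 = cong suc (m+n≡0⇒m≡0 x x+r≡0) ∷ xs≡1 , m+n≡0⇒n≡0 x x+r≡0

maxStable-size : IsAlpha A a → MaxStable A T → ∣ T ∣ ≡ a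
maxStable-size ((S , S-stable , ∣S∣≡a) , bound) (T-stable , T-largest) =
  ≤-antisym (bound _ T-stable) (subst (_≤ _) ∣S∣≡a (T-largest S S-stable))

IsAlpha⇒MaxStable : IsAlpha A a → Σ (Subset n) (MaxStable A)
IsAlpha⇒MaxStable ((S , S-stable , ∣S∣≡a) , bound) =
  S , S-stable , λ T T-stable → subst (∣ T ∣ ≤_) (sym ∣S∣≡a) (bound T T-stable)

stable⇒1≤χ∁+χ∁ : Stable A T → A u w ≡ true → 1 ≤ χ (∁ T) u + χ (∁ T) w
stable⇒1≤χ∁+χ∁ {T = T} {u = u} {w = w} stable uw with u ∈? ∁ T | w ∈? ∁ T
... | yes _    | _        = s≤s z≤n
... | no  _    | yes _    = s≤s z≤n
... | no  u∉∁T | no  w∉∁T =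
  contradiction (trans (sym uw) (stable u w (x∉∁p⇒x∈p u∉∁T) (x∉∁p⇒x∈p w∉∁T))) λ ()

module KönigEgerváry {n a m : ℕ} {A : Adj n} (α : IsAlpha A a) (a+m≡n : a + m ≡ n)
  {M : List (Fin n × Fin n)} (M-matching : IsMatching A M) (∣M∣≡m : length M ≡ m) where

  ∣∁T∣≡m : MaxStable A T → ∣ ∁ T ∣ ≡ m
  ∣∁T∣≡m {T = T} T-max = begin
    ∣ ∁ T ∣     ≡⟨ ∣∁p∣≡n∸∣p∣ T ⟩
    n ∸ ∣ T ∣   ≡⟨ cong₂ _∸_ (sym a+m≡n) (maxStable-size α T-max) ⟩
    a + m ∸ a   ≡⟨ m+n∸m≡n a m ⟩
    m           ∎

  leaves-tight : MaxStable A T →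
    All (λ e → edgeSum (χ (∁ T)) e ≡ 1) M × ∑[ v < n ] zeroOn (endpoints M) (χ (∁ T)) v ≡ 0
  leaves-tight {T = T} T-max@(T-stable , _) =
    map₁ All.map⁻ (sum+r≡length⇒all≡1 (All.map⁺ each-edge-leaves) count)
    where
    out : Fin n → ℕ
    out = χ (∁ T)
    each-edge-leaves : All (λ e → 1 ≤ edgeSum out e) M
    each-edge-leaves = All.map (stable⇒1≤χ∁+χ∁ T-stable) (proj₁ M-matching)
    count : sum (map (edgeSum out) M) + ∑[ v < n ] zeroOn (endpoints M) out v
          ≡ length (map (edgeSum out) M)
    count = begin
      sum (map (edgeSum out) M) + ∑[ v < n ] zeroOn (endpoints M) out v
        ≡⟨ cong (_+ ∑[ v < n ] zeroOn (endpoints M) out v) (sum-endpoints out M) ⟨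
      sum (map out (endpoints M)) + ∑[ v < n ] zeroOn (endpoints M) out v
        ≡⟨ ∑-split (proj₂ M-matching) out ⟨
      ∑[ v < n ] out v              ≡⟨ ∣p∣≡∑χ (∁ T) ⟨
      ∣ ∁ T ∣                       ≡⟨ ∣∁T∣≡m T-max ⟩
      m                             ≡⟨ ∣M∣≡m ⟨
      length M                      ≡⟨ length-map (edgeSum out) M ⟨
      length (map (edgeSum out) M)  ∎

  matched-leaves-once : MaxStable A T → (u , w) ∈ₗ M → χ (∁ T) u + χ (∁ T) w ≡ 1
  matched-leaves-once T-max = All.lookup (proj₁ (leaves-tight T-max))

  unmatched-∈ : MaxStable A T → v ∉ₗ endpoints M → v ∈ T
  unmatched-∈ {T = T} {v = v} T-max v∉M = x∉∁p⇒x∈p (χ≡0⇒∉ (begin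
    χ (∁ T) v                          ≡⟨ zeroOn-∉ {h = χ (∁ T)} v∉M ⟨
    zeroOn (endpoints M) (χ (∁ T)) v   ≡⟨ ∑≡0⇒≡0 (proj₂ (leaves-tight T-max)) v ⟩
    0                                  ∎))

  module _ {C D : Subset n}
    (C-core : ∀ v → v ∈ C ⇔ (∀ S → MaxStable A S → v ∈ S))
    (D-σ : ∀ v → v ∈ D ⇔ (∀ S → MaxStable A S → v ∉ S)) where

    S₀ : Subset n
    S₀ = proj₁ (IsAlpha⇒MaxStable α)

    S₀-max : MaxStable A S₀
    S₀-max = proj₂ (IsAlpha⇒MaxStable α)

    core⇔σ : (∀ T → MaxStable A T → u ∈ T ⇔ w ∉ T) → u ∈ C ⇔ w ∈ D
    core⇔σ {u = u} {w = w} u∈⇔w∉ = mk⇔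
      (λ u∈C → from (D-σ w) λ T T-max → to (u∈⇔w∉ T T-max) (to (C-core u) u∈C T T-max))
      (λ w∈D → from (C-core u) λ T T-max → from (u∈⇔w∉ T T-max) (to (D-σ w) w∈D T T-max))

    coreWeight σWeight : Fin n → ℕ
    coreWeight v = χ C v + χ (∁ S₀) v
    σWeight    v = χ D v + χ S₀ v

    exactly-one-swap : ∀ u w → (∀ {T} → MaxStable A T → χ (∁ T) u + χ (∁ T) w ≡ 1) →
      coreWeight u ≡ σWeight w
    exactly-one-swap u w leaves-once = cong₂ _+_
      (χ-cong (core⇔σ {u = u} {w = w} λ T T-max → χ∁+χ∁≡1⇒∈⇔∉ (leaves-once T-max)))
      (χ-cong (mk⇔ (λ u∈∁S₀ → from w∈S₀⇔u∉S₀ (x∈∁p⇒x∉p u∈∁S₀))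
                   (λ w∈S₀ → x∉p⇒x∈∁p (to w∈S₀⇔u∉S₀ w∈S₀))))
      where
      w∈S₀⇔u∉S₀ : w ∈ S₀ ⇔ u ∉ S₀
      w∈S₀⇔u∉S₀ = χ∁+χ∁≡1⇒∈⇔∉ (trans (+-comm (χ (∁ S₀) w) (χ (∁ S₀) u)) (leaves-once S₀-max))

    unmatched-swap : ∀ v → v ∉ₗ endpoints M → coreWeight v ≡ σWeight v
    unmatched-swap v v∉M = trans
      (cong₂ _+_
        (χ-cong (mk⇔ (λ _ → v∈S₀) (λ _ → from (C-core v) λ T T-max → unmatched-∈ T-max v∉M)))
        (χ-cong (mk⇔ (λ v∈∁S₀ → contradiction v∈S₀ (x∈∁p⇒x∉p v∈∁S₀))
                     (λ v∈D → contradiction v∈S₀ (to (D-σ v) v∈D S₀ S₀-max)))))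
      (+-comm (χ S₀ v) (χ D v))
      where
      v∈S₀ : v ∈ S₀
      v∈S₀ = unmatched-∈ S₀-max v∉M

    matched-swap : All (λ e → edgeSum coreWeight e ≡ edgeSum σWeight e) M
    matched-swap = All.tabulate λ {(u , w)} uw∈M → trans
      (cong₂ _+_
        (exactly-one-swap u w (λ T-max → matched-leaves-once T-max uw∈M))
        (exactly-one-swap w u (λ {T} T-max →
          trans (+-comm (χ (∁ T) w) (χ (∁ T) u)) (matched-leaves-once T-max uw∈M))))
      (+-comm (σWeight w) (σWeight u))

    ∣core∣+μ≡∣σ∣+α : ∣ C ∣ + m ≡ ∣ D ∣ + a
    ∣core∣+μ≡∣σ∣+α = begin
      ∣ C ∣ + m                                  ≡⟨ cong (∣ C ∣ +_) (∣∁T∣≡m S₀-max) ⟨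
      ∣ C ∣ + ∣ ∁ S₀ ∣                           ≡⟨ cong₂ _+_ (∣p∣≡∑χ C) (∣p∣≡∑χ (∁ S₀)) ⟩
      ∑[ v < n ] χ C v + ∑[ v < n ] χ (∁ S₀) v   ≡⟨ ∑-distrib-+ (χ C) (χ (∁ S₀)) ⟨
      ∑[ v < n ] coreWeight v
        ≡⟨ ∑-cong-matching (proj₂ M-matching) matched-swap unmatched-swap ⟩
      ∑[ v < n ] σWeight v                       ≡⟨ ∑-distrib-+ (χ D) (χ S₀) ⟩
      ∑[ v < n ] χ D v + ∑[ v < n ] χ S₀ v       ≡⟨ cong₂ _+_ (∣p∣≡∑χ D) (∣p∣≡∑χ S₀) ⟨
      ∣ D ∣ + ∣ S₀ ∣                             ≡⟨ cong (∣ D ∣ +_) (maxStable-size α S₀-max) ⟩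
      ∣ D ∣ + a                                  ∎

module _ {p q a m : ℕ} (p+m≡q+a : p + m ≡ q + a) where

  p≡a⇔q≡m : p ≡ a ⇔ q ≡ m
  p≡a⇔q≡m = mk⇔
    (λ p≡a → +-cancelʳ-≡ a q m (trans (sym p+m≡q+a) (trans (cong (_+ m) p≡a) (+-comm a m))))
    (λ q≡m → +-cancelʳ-≡ m p a (trans p+m≡q+a (trans (cong (_+ a) q≡m) (+-comm m a))))

  q≡m⇔p+q≡a+m : q ≡ m ⇔ p + q ≡ a + m
  q≡m⇔p+q≡a+m = mk⇔ (λ q≡m → cong₂ _+_ (from p≡a⇔q≡m q≡m) q≡m) halve
    where
    halve : p + q ≡ a + m → q ≡ m
    halve p+q≡a+m = *-cancelˡ-≡ q m 2 (+-cancelʳ-≡ (p + a) (2 * q) (2 * m) (begin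
      2 * q + (p + a)      ≡⟨ regroupˡ p q a ⟩
      (p + q) + (q + a)    ≡⟨ cong₂ _+_ p+q≡a+m (sym p+m≡q+a) ⟩
      (a + m) + (p + m)    ≡⟨ regroupʳ p a m ⟩
      2 * m + (p + a)      ∎))
      where
      regroupˡ : ∀ p q a → 2 * q + (p + a) ≡ (p + q) + (q + a)
      regroupˡ = solve-∀
      regroupʳ : ∀ p a m → (a + m) + (p + m) ≡ 2 * m + (p + a)
      regroupʳ = solve-∀

ke-equivalences : ∀ {n a m x s e : ℕ} → a + m ≡ n → x + m ≡ s + a →
  ((x + e ≡ a) ⇔ (s + e ≡ m)) × ((s + e ≡ m) ⇔ (x + 2 * e + s ≡ n))
ke-equivalences {n} {a} {m} {x} {s} {e} a+m≡n x+m≡s+a =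
  p≡a⇔q≡m balanced ,
  subst₂ (λ l r → (s + e ≡ m) ⇔ (l ≡ r)) (sym split) a+m≡n (q≡m⇔p+q≡a+m balanced)
  where
  balanced : (x + e) + m ≡ (s + e) + a
  balanced = begin
    (x + e) + m   ≡⟨ xy∙z≈xz∙y x e m ⟩
    (x + m) + e   ≡⟨ cong (_+ e) x+m≡s+a ⟩
    (s + a) + e   ≡⟨ xy∙z≈xz∙y s a e ⟩
    (s + e) + a   ∎
  split : x + 2 * e + s ≡ (x + e) + (s + e)
  split = regroup x e s
    where
    regroup : ∀ x e s → x + 2 * e + s ≡ (x + e) + (s + e)
    regroup = solve-∀

proposition3p6 : ∀ (n : ℕ) (A : Adj n) → IsGraph A → KonigEgervary A →
    ∀ (a m x s e : ℕ) → IsAlpha A a → IsMu A m → IsXi A x → IsSigma A s → IsEta A e →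
    ((x + e ≡ a) ⇔ (s + e ≡ m)) × ((s + e ≡ m) ⇔ (x + 2 * e + s ≡ n))
proposition3p6 n A _ ke a m x s e α μ@((M , M-matching , ∣M∣≡m) , _)
               (C , C-core , ∣C∣≡x) (D , D-σ , ∣D∣≡s) _ =
  ke-equivalences a+m≡n (subst₂ (λ c d → c + m ≡ d + a) ∣C∣≡x ∣D∣≡s
    (KönigEgerváry.∣core∣+μ≡∣σ∣+α α a+m≡n M-matching ∣M∣≡m C-core D-σ))
  where
  a+m≡n : a + m ≡ n
  a+m≡n = ke a m α μ
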